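{- Let $T$ be a tree on $n$ vertices with exactly $k$ pendent vertices such that $E_2(T)\neq \emptyset$, and let $uv$ be an edge of $T$ with $d(u) = r \geq 3$ and $d(v) = 1$. Then there exists a tree $T'$ on $n$ vertices with exactly $k$ pendent vertices such that $ABS(T) > ABS(T')$.
   Context: All graphs are finite and simple. For a vertex $u$ of a graph $G$, $d(u)=d_u$ denotes its degree. The atom-bond sum-connectivity index of $G$ is $ABS(G)=\sum_{uv\in E(G)}\sqrt{\frac{d_u+d_v-2}{d_u+d_v}}$. A pendent vertex is a vertex of degree $1$. $E_2(T)$ denotes the set of edges $uv$ of $T$ with $d(u)=d(v)=2$. -}

module Defs where

open import Data.Bool using (Bool; true; false; T; if_then_else_; _∧_)
open import Data.Nat using (ℕ; zero; suc; _∸_; _<ᵇ_; _≤_)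
import Data.Nat as ℕ
open import Data.Fin using (Fin; toℕ)
open import Data.List using (List; []; _∷_; _++_; map; allFin; concatMap; length; filterᵇ)
open import Data.Nat.ListAction using (sum)
open import Data.List.Relation.Unary.Linked using (Linked)
open import Data.List.Relation.Unary.Unique.Propositional using (Unique)
open import Data.List.Relation.Binary.Pointwise using (Pointwise)
open import Data.Product using (Σ; ∃; _×_; _,_)
open import Data.Integer using (+_)
open import Data.Rational using (ℚ; _/_; 0ℚ; _*_; _+_) renaming (_≤_ to _≤ℚ_; _<_ to _<ℚ_)
open import Relation.Binary.PropositionalEquality using (_≡_)
open import Relation.Nullary using (¬_)

record Graph (n : ℕ) : Set where
  field
    adj    : Fin n → Fin n → Bool
    sym    : ∀ i j → adj i j ≡ adj j i
    irrefl : ∀ i → adj i i ≡ false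
open Graph public

Adj : ∀ {n} → Graph n → Fin n → Fin n → Set
Adj G i j = T (adj G i j)

data Walk {n} (G : Graph n) : Fin n → Fin n → Set where
  here : ∀ {i} → Walk G i i
  step : ∀ {i j k} → Adj G i j → Walk G j k → Walk G i k

Connected : ∀ {n} → Graph n → Set
Connected {n} G = (i j : Fin n) → Walk G i j

-- A cycle: distinct vertices x, x1, ..., xm (m ≥ 2, so length ≥ 3),
-- consecutive ones adjacent, and xm adjacent to x.
Cycle : ∀ {n} → Graph n → Set
Cycle {n} G = Σ (Fin n) λ x → Σ (List (Fin n)) λ xs →
  (2 ≤ length xs) × Unique (x ∷ xs) × Linked (Adj G) (x ∷ xs ++ x ∷ [])

IsTree : ∀ {n} → Graph n → Set
IsTree {n} G = (1 ≤ n) × Connected G × ¬ Cycle G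

deg : ∀ {n} → Graph n → Fin n → ℕ
deg {n} G i = sum (map (λ j → if adj G i j then 1 else 0) (allFin n))

isOne : ℕ → Bool
isOne (suc zero) = true
isOne _ = false

pendentCount : ∀ {n} → Graph n → ℕ
pendentCount {n} G = length (filterᵇ (λ i → isOne (deg G i)) (allFin n))

E2NonEmpty : ∀ {n} → Graph n → Set
E2NonEmpty {n} G = Σ (Fin n) λ i → Σ (Fin n) λ j → Adj G i j × deg G i ≡ 2 × deg G j ≡ 2

edges : ∀ {n} → Graph n → List (Fin n × Fin n)
edges {n} G = concatMap (λ i → map (λ j → (i , j))
  (filterᵇ (λ j → (toℕ i <ᵇ toℕ j) ∧ adj G i j) (allFin n))) (allFin n)

-- (s - 2)/s as a rational (the value at s = 0 is never used: edges have s ≥ 2).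
absRatio : ℕ → ℚ
absRatio zero = 0ℚ
absRatio (suc m) = (+ (suc m ∸ 2)) / suc m

absRadicands : ∀ {n} → Graph n → List ℚ
absRadicands G = map (λ e → absRatio (deg G (Data.Product.proj₁ e) ℕ.+ deg G (Data.Product.proj₂ e))) (edges G)

sumℚ : List ℚ → ℚ
sumℚ [] = 0ℚ
sumℚ (x ∷ xs) = x + sumℚ xs

SqrtLB : ℚ → ℚ → Set
SqrtLB x a = (0ℚ ≤ℚ a) × (a * a ≤ℚ x)

SqrtUB : ℚ → ℚ → Set
SqrtUB y b = (0ℚ ≤ℚ b) × (y ≤ℚ b * b)

-- Σ √xᵢ > Σ √yⱼ  (for nonnegative rationals xᵢ, yⱼ), expressed exactly via
-- rational lower bounds of the left square roots and rational upper bounds of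
-- the right ones: the strict inequality of reals holds iff such bounds exist.
SumSqrtGt : List ℚ → List ℚ → Set
SumSqrtGt xs ys = Σ (List ℚ) λ as → Σ (List ℚ) λ bs →
  Pointwise SqrtLB xs as × Pointwise SqrtUB ys bs × (sumℚ bs <ℚ sumℚ as)

ABS-gt : ∀ {n m} → Graph n → Graph m → Set
ABS-gt G H = SumSqrtGt (absRadicands G) (absRadicands H)

-- Let x–y–z be a path with deg x = deg y = 2 and uv a pendent edge with deg u = r ≥ 3.
-- Taking y out of the path (joining x to z) and subdividing uv by y yields a tree T′
-- with the same degree sequence, hence the same pendent vertices.  With f(s) = √((s−2)/s)
-- the ABS index loses the terms of xy, yz, uv and gains those of xz, uy, yv, and yz, xz
-- carry the same term, so
--   ABS(T) − ABS(T′) = (f 4 − f 3) − (f (r+2) − f (r+1)) ≥ (7/10 − 7/12) − 9/80 = 1/240.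
-- To avoid square roots every term f(s) of T is replaced by ⌊N f(s)⌋/N from below and every
-- term of T′ by (⌊N f(s)⌋ + 1)/N from above; for N ≥ 240 (m + 2), m the number of edges,
-- the gap of N/240 outweighs the at most m + 2 units lost to rounding.

module Submission where

open import Defs hiding (sym)
open import Data.Bool using (Bool; true; false; T; if_then_else_; _∧_)
open import Data.Empty using (⊥; ⊥-elim)
open import Data.Fin using (Fin; zero; suc; toℕ)
open import Data.Fin.Properties using (_≟_; toℕ-injective)
import Data.Integer as ℤ
open import Data.Integer.Properties using (pos-*; pos-+)
open import Data.Integer.Tactic.RingSolver renaming (solve-∀ to ℤ-solve-∀)
open import Data.List using (List; []; _∷_; _++_; _∷ʳ_; map; allFin; tabulate; concat; filterᵇ; length; initLast; _∷ʳ′_)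
open import Data.List.Properties using (map-tabulate; tabulate-cong; map-cong; map-∘; concat-map; ++-assoc; length-++-sucʳ)
open import Data.List.Membership.Propositional using (_∈_; _∉_)
open import Data.List.Membership.Propositional.Properties using (∈-∃++; ∈-++⁺ʳ)
import Data.List.Membership.DecPropositional as DecMembership
open import Data.List.Relation.Binary.Pointwise using (map⁺)
open import Data.List.Relation.Binary.Pointwise.Properties using () renaming (refl to Pointwise-refl)
open import Data.List.Relation.Unary.All as All using (All; []; _∷_)
open import Data.List.Relation.Unary.All.Properties using (∷ʳ⁺; ∷ʳ⁻; ¬Any⇒All¬)
open import Data.List.Relation.Unary.AllPairs using ([]; _∷_)
open import Data.List.Relation.Unary.Any using (here; there)
open import Data.List.Relation.Unary.Linked as Linked using (Linked; []; [-]; _∷_)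
open import Data.List.Relation.Unary.Unique.Propositional using (Unique)
open import Data.Nat using (ℕ; zero; suc; pred; _+_; _*_; _∸_; _≤_; _<_; _<ᵇ_; z≤n; s≤s)
open import Data.Nat.ListAction using (sum)
open import Data.Nat.ListAction.Properties using (sum-++)
open import Data.Nat.Properties hiding (_≟_)
open import Data.Nat.Tactic.RingSolver using (solve-∀)
open import Data.Product using (Σ; ∃; _×_; _,_; proj₁; proj₂)
open import Data.Rational as ℚ using (ℚ; 0ℚ)
open import Data.Rational.Properties
  using (toℚᵘ-fromℚᵘ; toℚᵘ-cancel-≤; toℚᵘ-cancel-<; toℚᵘ-homo-*; toℚᵘ-homo-+; toℚᵘ-injective;
         nonNegative⁻¹; normalize-nonNeg; 0/n≡0)
open import Data.Rational.Unnormalised as ℚᵘ using (mkℚᵘ; *≡*; *≤*; *<*)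
import Data.Rational.Unnormalised.Properties as ℚᵘ
open import Data.Sum using (_⊎_; inj₁; inj₂; [_,_]′)
open import Function using (_∘_; mk⇔)
open import Relation.Binary.Definitions using (tri<; tri≈; tri>)
open import Relation.Binary.PropositionalEquality
open import Relation.Nullary using (¬_; Dec; yes; no; does; _×-dec_; _⊎-dec_; contradiction)
open import Relation.Nullary.Decidable using (dec-true; dec-false; does-⇔)
open import Algebra.Properties.CommutativeSemigroup +-commutativeSemigroup using (x∙yz≈y∙xz; xy∙z≈xz∙y)

-- Integer square roots and the numerical gap

square-cancel-< : ∀ {m n} → m * m < n * n → m < n
square-cancel-< {m} {n} m²<n² with m <? n
... | yes m<n = m<n
... | no m≮n = contradiction m²<n² (≤⇒≯ (*-mono-≤ n≤m n≤m))
  where n≤m = ≮⇒≥ m≮n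

square-cancel-≤ : ∀ {m n} → m * m ≤ n * n → m ≤ n
square-cancel-≤ {m} {n} m²≤n² with n <? m
... | yes n<m = contradiction m²≤n² (<⇒≱ (*-mono-< n<m n<m))
... | no n≮m = ≮⇒≥ n≮m

sqrtFloor : ℕ → ℕ → ℕ → ℕ
sqrtFloor a s zero = zero
sqrtFloor a s (suc b) with suc b * suc b * s ≤? a
... | yes _ = suc b
... | no _ = sqrtFloor a s b

sqrtFloor-sq≤ : ∀ a s b → sqrtFloor a s b * sqrtFloor a s b * s ≤ a
sqrtFloor-sq≤ a s zero = z≤n
sqrtFloor-sq≤ a s (suc b) with suc b * suc b * s ≤? a
... | yes fits = fits
... | no _ = sqrtFloor-sq≤ a s b

sqrtFloor-<sq : ∀ a s b → a < suc b * suc b * s →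
  a < suc (sqrtFloor a s b) * suc (sqrtFloor a s b) * s
sqrtFloor-<sq a s zero a<s = a<s
sqrtFloor-<sq a s (suc b) a<bound with suc b * suc b * s ≤? a
... | yes _ = a<bound
... | no misses = sqrtFloor-<sq a s b (≰⇒> misses)

-- absRoot N s = ⌊N √((s − 2)/s)⌋, and 0 at s = 0 like absRatio.
absRoot : ℕ → ℕ → ℕ
absRoot N zero = zero
absRoot N (suc s) = sqrtFloor ((suc s ∸ 2) * (N * N)) (suc s) N

absRoot-sq≤ : ∀ N s → absRoot N (suc s) * absRoot N (suc s) * suc s ≤ (suc s ∸ 2) * (N * N)
absRoot-sq≤ N s = sqrtFloor-sq≤ _ (suc s) N

absRoot-<sq : ∀ N s → (suc s ∸ 2) * (N * N) < suc (absRoot N (suc s)) * suc (absRoot N (suc s)) * suc s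
absRoot-<sq N s = sqrtFloor-<sq _ (suc s) N (begin-strict
  (suc s ∸ 2) * (N * N) ≤⟨ *-monoˡ-≤ (N * N) (m∸n≤m (suc s) 2) ⟩
  suc s * (N * N)       ≡⟨ *-comm (suc s) (N * N) ⟩
  N * N * suc s         <⟨ *-monoˡ-< (suc s) (*-mono-< (n<1+n N) (n<1+n N)) ⟩
  suc N * suc N * suc s ∎)
  where open ≤-Reasoning

-- The rational brackets 7/10 < √(1/2), √(1/3) ≤ 7/12, √((t+3)/(t+5)) ≤ (t+4)/(t+5) and
-- (t²+7t+11)/(t+4)² < √((t+2)/(t+4)); the last two differ by (2t+9)/((t+5)(t+4)²) ≤ 9/80.
absRoot-4-lower : ∀ N → 7 * N < 10 * suc (absRoot N 4)
absRoot-4-lower N = square-cancel-< (begin-strict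
  7 * N * (7 * N)   ≤⟨ ≤-trans (≤-reflexive (lhs N)) (*-monoˡ-≤ (N * N) (m≤m+n 49 1)) ⟩
  50 * (N * N)      ≡⟨ mid N ⟩
  25 * (2 * (N * N)) <⟨ *-monoʳ-< 25 (absRoot-<sq N 3) ⟩
  25 * (P * P * 4)  ≡⟨ rhs P ⟩
  10 * P * (10 * P) ∎)
  where
  open ≤-Reasoning
  P : ℕ
  P = suc (absRoot N 4)
  lhs : ∀ N → 7 * N * (7 * N) ≡ 49 * (N * N)
  lhs = solve-∀
  mid : ∀ N → 50 * (N * N) ≡ 25 * (2 * (N * N))
  mid = solve-∀
  rhs : ∀ P → 25 * (P * P * 4) ≡ 10 * P * (10 * P)
  rhs = solve-∀

absRoot-3-upper : ∀ N → 12 * absRoot N 3 ≤ 7 * N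
absRoot-3-upper N = square-cancel-≤ (begin
  12 * P * (12 * P)   ≡⟨ lhs P ⟩
  48 * (P * P * 3)    ≤⟨ *-monoʳ-≤ 48 (absRoot-sq≤ N 2) ⟩
  48 * (1 * (N * N))  ≤⟨ ≤-trans (≤-reflexive (mid N)) (*-monoˡ-≤ (N * N) (m≤m+n 48 1)) ⟩
  49 * (N * N)        ≡⟨ rhs N ⟩
  7 * N * (7 * N)     ∎)
  where
  open ≤-Reasoning
  P : ℕ
  P = absRoot N 3
  lhs : ∀ P → 12 * P * (12 * P) ≡ 48 * (P * P * 3)
  lhs = solve-∀
  mid : ∀ N → 48 * (1 * (N * N)) ≡ 48 * (N * N)
  mid = solve-∀
  rhs : ∀ N → 49 * (N * N) ≡ 7 * N * (7 * N)
  rhs = solve-∀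

absRoot-5+t-upper : ∀ N t → absRoot N (5 + t) * (5 + t) ≤ (4 + t) * N
absRoot-5+t-upper N t = square-cancel-≤ (begin
  Q * (5 + t) * (Q * (5 + t))      ≡⟨ lhs Q t ⟩
  Q * Q * (5 + t) * (5 + t)        ≤⟨ *-monoˡ-≤ (5 + t) (absRoot-sq≤ N (4 + t)) ⟩
  (3 + t) * (N * N) * (5 + t)      ≡⟨ mid N t ⟩
  (3 + t) * (5 + t) * (N * N)      ≤⟨ *-monoˡ-≤ (N * N) (≤-trans (n≤1+n _) (≤-reflexive (sym (square t)))) ⟩
  (4 + t) * (4 + t) * (N * N)      ≡⟨ rhs N t ⟩
  (4 + t) * N * ((4 + t) * N)      ∎)
  where
  open ≤-Reasoning
  Q : ℕ
  Q = absRoot N (5 + t)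
  lhs : ∀ Q t → Q * (5 + t) * (Q * (5 + t)) ≡ Q * Q * (5 + t) * (5 + t)
  lhs = solve-∀
  mid : ∀ N t → (3 + t) * (N * N) * (5 + t) ≡ (3 + t) * (5 + t) * (N * N)
  mid = solve-∀
  square : ∀ t → (4 + t) * (4 + t) ≡ 1 + (3 + t) * (5 + t)
  square = solve-∀
  rhs : ∀ N t → (4 + t) * (4 + t) * (N * N) ≡ (4 + t) * N * ((4 + t) * N)
  rhs = solve-∀

absRoot-4+t-lower : ∀ N t → N * (11 + 7 * t + t * t) < suc (absRoot N (4 + t)) * ((4 + t) * (4 + t))
absRoot-4+t-lower N t = square-cancel-< (begin-strict
  N * K * (N * K)                                  ≡⟨ lhs N K ⟩
  N * N * (K * K)                                  ≤⟨ *-monoʳ-≤ (N * N) (≤-trans (m≤m+n (K * K) _) (≤-reflexive (sym (cube t)))) ⟩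
  N * N * ((2 + t) * ((4 + t) * (4 + t) * (4 + t)))  ≡⟨ mid N t ⟩
  (2 + t) * (N * N) * ((4 + t) * (4 + t) * (4 + t))  <⟨ *-monoˡ-< ((4 + t) * (4 + t) * (4 + t)) (absRoot-<sq N (3 + t)) ⟩
  P * P * (4 + t) * ((4 + t) * (4 + t) * (4 + t))  ≡⟨ rhs P t ⟩
  P * ((4 + t) * (4 + t)) * (P * ((4 + t) * (4 + t))) ∎)
  where
  open ≤-Reasoning
  K P : ℕ
  K = 11 + 7 * t + t * t
  P = suc (absRoot N (4 + t))
  lhs : ∀ N K → N * K * (N * K) ≡ N * N * (K * K)
  lhs = solve-∀
  cube : ∀ t → (2 + t) * ((4 + t) * (4 + t) * (4 + t)) ≡ (11 + 7 * t + t * t) * (11 + 7 * t + t * t) + (t * t + 6 * t + 7)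
  cube = solve-∀
  mid : ∀ N t → N * N * ((2 + t) * ((4 + t) * (4 + t) * (4 + t))) ≡ (2 + t) * (N * N) * ((4 + t) * (4 + t) * (4 + t))
  mid = solve-∀
  rhs : ∀ P t → P * P * (4 + t) * ((4 + t) * (4 + t) * (4 + t)) ≡ P * ((4 + t) * (4 + t)) * (P * ((4 + t) * (4 + t)))
  rhs = solve-∀

absRoot-increment-bound : ∀ N t → 80 * absRoot N (5 + t) < 80 * absRoot N (4 + t) + 80 + 9 * N
absRoot-increment-bound N t = *-cancelʳ-< X _ _ (begin-strict
  80 * Q * X                                      ≡⟨ lhs t Q ⟩
  80 * (4 + t) * (4 + t) * (Q * (5 + t))          ≤⟨ *-monoʳ-≤ (80 * (4 + t) * (4 + t)) (absRoot-5+t-upper N t) ⟩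
  80 * (4 + t) * (4 + t) * ((4 + t) * N)          ≤⟨ m≤m+n _ (N * (9 * t * t * t + 117 * t * t + 344 * t)) ⟩
  80 * (4 + t) * (4 + t) * ((4 + t) * N) + N * (9 * t * t * t + 117 * t * t + 344 * t)
                                                  ≡⟨ mid t N ⟩
  80 * (N * K) * (5 + t) + 9 * N * X              <⟨ +-monoˡ-< (9 * N * X) (*-monoˡ-< (5 + t) (*-monoʳ-< 80 (absRoot-4+t-lower N t))) ⟩
  80 * (suc P * ((4 + t) * (4 + t))) * (5 + t) + 9 * N * X ≡⟨ rhs t N P ⟩
  (80 * P + 80 + 9 * N) * X                       ∎)
  where
  open ≤-Reasoning
  K X P Q : ℕ
  K = 11 + 7 * t + t * t
  X = (4 + t) * (4 + t) * (5 + t)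
  P = absRoot N (4 + t)
  Q = absRoot N (5 + t)
  lhs : ∀ t Q → 80 * Q * ((4 + t) * (4 + t) * (5 + t)) ≡ 80 * (4 + t) * (4 + t) * (Q * (5 + t))
  lhs = solve-∀
  mid : ∀ t N → 80 * (4 + t) * (4 + t) * ((4 + t) * N) + N * (9 * t * t * t + 117 * t * t + 344 * t)
              ≡ 80 * (N * (11 + 7 * t + t * t)) * (5 + t) + 9 * N * ((4 + t) * (4 + t) * (5 + t))
  mid = solve-∀
  rhs : ∀ t N P → 80 * (suc P * ((4 + t) * (4 + t))) * (5 + t) + 9 * N * ((4 + t) * (4 + t) * (5 + t))
              ≡ (80 * P + 80 + 9 * N) * ((4 + t) * (4 + t) * (5 + t))
  rhs = solve-∀

absRoot-gap : ∀ m N t → 240 * (2 + m) ≤ N →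
  m + absRoot N (5 + t) + absRoot N 3 < absRoot N 4 + absRoot N (4 + t)
absRoot-gap m N t N-large = *-cancelˡ-< 240 _ _ (+-cancelˡ-< 240 _ _ (begin-strict
  240 + 240 * (m + Q + R₃)                             ≡⟨ lhs m Q R₃ ⟩
  240 * m + 3 * (80 * Q) + 20 * (12 * R₃) + 240        <⟨ +-monoˡ-< 240 (+-mono-<-≤ (+-monoʳ-< (240 * m) (*-monoʳ-< 3 (absRoot-increment-bound N t)))
                                                                                      (*-monoʳ-≤ 20 (absRoot-3-upper N))) ⟩
  240 * m + 3 * (80 * P + 80 + 9 * N) + 20 * (7 * N) + 240 ≡⟨ mid m P N ⟩
  240 * P + 167 * N + 240 * (2 + m)                    ≤⟨ +-monoʳ-≤ (240 * P + 167 * N) N-large ⟩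
  240 * P + 167 * N + N                                ≡⟨ mid′ P N ⟩
  240 * P + 24 * (7 * N)                               <⟨ +-monoʳ-< (240 * P) (*-monoʳ-< 24 (absRoot-4-lower N)) ⟩
  240 * P + 24 * (10 * suc R₄)                          ≡⟨ rhs P R₄ ⟩
  240 + 240 * (R₄ + P)                                 ∎))
  where
  open ≤-Reasoning
  P Q R₃ R₄ : ℕ
  P = absRoot N (4 + t)
  Q = absRoot N (5 + t)
  R₃ = absRoot N 3
  R₄ = absRoot N 4
  lhs : ∀ m Q R → 240 + 240 * (m + Q + R) ≡ 240 * m + 3 * (80 * Q) + 20 * (12 * R) + 240
  lhs = solve-∀
  mid : ∀ m P N → 240 * m + 3 * (80 * P + 80 + 9 * N) + 20 * (7 * N) + 240 ≡ 240 * P + 167 * N + 240 * (2 + m)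
  mid = solve-∀
  mid′ : ∀ P N → 240 * P + 167 * N + N ≡ 240 * P + 24 * (7 * N)
  mid′ = solve-∀
  rhs : ∀ P R → 240 * P + 24 * (10 * suc R) ≡ 240 + 240 * (R + P)
  rhs = solve-∀

-- Rational bounds for the ABS terms

-- frac a d = a/(d + 1), so the denominator is never zero.
frac : ℕ → ℕ → ℚ
frac a d = ℤ.+ a ℚ./ suc d

toℚᵘ-frac : ∀ a d → ℚ.toℚᵘ (frac a d) ℚᵘ.≃ mkℚᵘ (ℤ.+ a) d
toℚᵘ-frac a d = toℚᵘ-fromℚᵘ (mkℚᵘ (ℤ.+ a) d)

mkℚᵘ-≤ : ∀ {a b c d} → a * suc d ≤ c * suc b → mkℚᵘ (ℤ.+ a) b ℚᵘ.≤ mkℚᵘ (ℤ.+ c) d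
mkℚᵘ-≤ {a} {b} {c} {d} h = *≤* (subst₂ ℤ._≤_ (pos-* a (suc d)) (pos-* c (suc b)) (ℤ.+≤+ h))

mkℚᵘ-< : ∀ {a b c d} → a * suc d < c * suc b → mkℚᵘ (ℤ.+ a) b ℚᵘ.< mkℚᵘ (ℤ.+ c) d
mkℚᵘ-< {a} {b} {c} {d} h = *<* (subst₂ ℤ._<_ (pos-* a (suc d)) (pos-* c (suc b)) (ℤ.+<+ h))

toℚᵘ-frac² : ∀ a b → ℚ.toℚᵘ (frac a b ℚ.* frac a b) ℚᵘ.≃ mkℚᵘ (ℤ.+ (a * a)) (pred (suc b * suc b))
toℚᵘ-frac² a b = ℚᵘ.≃-trans (toℚᵘ-homo-* (frac a b) (frac a b))
  (ℚᵘ.≃-trans (ℚᵘ.*-cong (toℚᵘ-frac a b) (toℚᵘ-frac a b)) (*≡* (cong (ℤ._* ℤ.+ (suc b * suc b)) (sym (pos-* a a)))))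

frac-nonNeg : ∀ a d → 0ℚ ℚ.≤ frac a d
frac-nonNeg a d = nonNegative⁻¹ (frac a d) {{normalize-nonNeg a (suc d)}}

frac-< : ∀ a b c d → a * suc d < c * suc b → frac a b ℚ.< frac c d
frac-< a b c d h = toℚᵘ-cancel-<
  (ℚᵘ.<-respˡ-≃ (ℚᵘ.≃-sym (toℚᵘ-frac a b)) (ℚᵘ.<-respʳ-≃ (ℚᵘ.≃-sym (toℚᵘ-frac c d)) (mkℚᵘ-< h)))

frac²-≤ : ∀ a b c d → a * a * suc d ≤ c * (suc b * suc b) → frac a b ℚ.* frac a b ℚ.≤ frac c d
frac²-≤ a b c d h = toℚᵘ-cancel-≤
  (ℚᵘ.≤-respˡ-≃ (ℚᵘ.≃-sym (toℚᵘ-frac² a b)) (ℚᵘ.≤-respʳ-≃ (ℚᵘ.≃-sym (toℚᵘ-frac c d)) (mkℚᵘ-≤ h)))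

≤-frac² : ∀ a b c d → c * (suc b * suc b) ≤ a * a * suc d → frac c d ℚ.≤ frac a b ℚ.* frac a b
≤-frac² a b c d h = toℚᵘ-cancel-≤
  (ℚᵘ.≤-respˡ-≃ (ℚᵘ.≃-sym (toℚᵘ-frac c d)) (ℚᵘ.≤-respʳ-≃ (ℚᵘ.≃-sym (toℚᵘ-frac² a b)) (mkℚᵘ-≤ h)))

frac-+ : ∀ a b d → frac a d ℚ.+ frac b d ≡ frac (a + b) d
frac-+ a b d = toℚᵘ-injective (ℚᵘ.≃-trans (toℚᵘ-homo-+ (frac a d) (frac b d))
  (ℚᵘ.≃-trans (ℚᵘ.+-cong (toℚᵘ-frac a d) (toℚᵘ-frac b d))
  (ℚᵘ.≃-trans (*≡* common) (ℚᵘ.≃-sym (toℚᵘ-frac (a + b) d)))))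
  where
  distrib : ∀ a b n → (a ℤ.* n ℤ.+ b ℤ.* n) ℤ.* n ≡ (a ℤ.+ b) ℤ.* (n ℤ.* n)
  distrib = ℤ-solve-∀
  common : (ℤ.+ a ℤ.* ℤ.+ suc d ℤ.+ ℤ.+ b ℤ.* ℤ.+ suc d) ℤ.* ℤ.+ suc d ≡ ℤ.+ (a + b) ℤ.* ℤ.+ (suc d * suc d)
  common = trans (distrib (ℤ.+ a) (ℤ.+ b) (ℤ.+ suc d)) (sym (cong₂ ℤ._*_ (pos-+ a b) (pos-* (suc d) (suc d))))

sumℚ-frac : ∀ {A : Set} (f : A → ℕ) d xs → sumℚ (map (λ x → frac (f x) d) xs) ≡ frac (sum (map f xs)) d
sumℚ-frac f d [] = sym (0/n≡0 (suc d))
sumℚ-frac f d (x ∷ xs) = trans (cong (λ q → frac (f x) d ℚ.+ q) (sumℚ-frac f d xs)) (frac-+ (f x) _ d)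

absRoot-lowerBound : ∀ d s → SqrtLB (absRatio s) (frac (absRoot (suc d) s) d)
absRoot-lowerBound d zero = frac-nonNeg 0 d , frac²-≤ 0 d 0 0 z≤n
absRoot-lowerBound d (suc s) = frac-nonNeg R d , frac²-≤ R d (suc s ∸ 2) s (absRoot-sq≤ (suc d) s)
  where R : ℕ
        R = absRoot (suc d) (suc s)

absRoot-upperBound : ∀ d s → SqrtUB (absRatio s) (frac (suc (absRoot (suc d) s)) d)
absRoot-upperBound d zero = frac-nonNeg 1 d , ≤-frac² 1 d 0 0 z≤n
absRoot-upperBound d (suc s) = frac-nonNeg (suc R) d , ≤-frac² (suc R) d (suc s ∸ 2) s (<⇒≤ (absRoot-<sq (suc d) s))
  where R : ℕ
        R = absRoot (suc d) (suc s)

degSum : {n : ℕ} → Graph n → Fin n × Fin n → ℕ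
degSum G e = deg G (proj₁ e) + deg G (proj₂ e)

ABS-gt-from-roots : {n n′ : ℕ} (G : Graph n) (H : Graph n′) (d : ℕ) →
  sum (map (λ e → suc (absRoot (suc d) (degSum H e))) (edges H)) < sum (map (λ e → absRoot (suc d) (degSum G e)) (edges G)) →
  ABS-gt G H
ABS-gt-from-roots {n} {n′} G H d roots< =
  map (λ e → frac (lower e) d) (edges G) , map (λ e → frac (upper e) d) (edges H) ,
  map⁺ _ _ (Pointwise-refl (λ {e} → absRoot-lowerBound d (degSum G e))) ,
  map⁺ _ _ (Pointwise-refl (λ {e} → absRoot-upperBound d (degSum H e))) ,
  subst₂ ℚ._<_ (sym (sumℚ-frac upper d (edges H))) (sym (sumℚ-frac lower d (edges G)))
    (frac-< (sum (map upper (edges H))) d (sum (map lower (edges G))) d (*-monoˡ-< (suc d) roots<))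
  where
  lower : Fin n × Fin n → ℕ
  lower e = absRoot (suc d) (degSum G e)
  upper : Fin n′ × Fin n′ → ℕ
  upper e = suc (absRoot (suc d) (degSum H e))

-- Sums over Fin n, degrees and neighbours

variable
  n : ℕ
  G : Graph n

Adj-sym : (G : Graph n) {i j : Fin n} → Adj G i j → Adj G j i
Adj-sym G {i} {j} = subst T (Graph.sym G i j)

Adj⇒≡true : (G : Graph n) {i j : Fin n} → Adj G i j → adj G i j ≡ true
Adj⇒≡true G {i} {j} a with adj G i j
... | true = refl

≡true⇒Adj : (G : Graph n) {i j : Fin n} → adj G i j ≡ true → Adj G i j
≡true⇒Adj G e = subst T (sym e) _

¬Adj⇒≡false : (G : Graph n) {i j : Fin n} → ¬ Adj G i j → adj G i j ≡ false
¬Adj⇒≡false G {i} {j} ¬a with adj G i j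
... | false = refl
... | true = ⊥-elim (¬a _)

Adj⇒≢ : (G : Graph n) {i j : Fin n} → Adj G i j → i ≢ j
Adj⇒≢ G {i} a refl = subst T (irrefl G i) a

∑ : (Fin n → ℕ) → ℕ
∑ f = sum (tabulate f)

sum-map-allFin : (f : Fin n → ℕ) → sum (map f (allFin n)) ≡ ∑ f
sum-map-allFin f = cong sum (map-tabulate (λ j → j) f)

∑-cong : {f g : Fin n → ℕ} → (∀ j → f j ≡ g j) → ∑ f ≡ ∑ g
∑-cong f≗g = cong sum (tabulate-cong f≗g)

except : (Fin n → ℕ) → Fin n → Fin n → ℕ
except f a j = if does (j ≟ a) then 0 else f j

∑-except : (f : Fin n → ℕ) (a : Fin n) → ∑ f ≡ f a + ∑ (except f a)
∑-except {suc n} f zero = refl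
∑-except {suc n} f (suc a) = trans (cong (f zero +_) (∑-except (f ∘ suc) a)) (x∙yz≈y∙xz (f zero) (f (suc a)) _)

except-≢ : (f : Fin n → ℕ) {a j : Fin n} → j ≢ a → except f a j ≡ f j
except-≢ f {a} {j} j≢a = cong (if_then 0 else f j) (dec-false (j ≟ a) j≢a)

∑-update : (f g : Fin n → ℕ) (a : Fin n) → (∀ j → j ≢ a → g j ≡ f j) → ∑ g + f a ≡ ∑ f + g a
∑-update f g a g≗f = begin
  ∑ g + f a                     ≡⟨ cong (_+ f a) (∑-except g a) ⟩
  g a + ∑ (except g a) + f a    ≡⟨ cong (λ s → g a + s + f a) (∑-cong same) ⟩
  g a + ∑ (except f a) + f a    ≡⟨ xy∙z≈xz∙y (g a) _ (f a) ⟩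
  g a + f a + ∑ (except f a)    ≡⟨ cong (_+ ∑ (except f a)) (+-comm (g a) (f a)) ⟩
  f a + g a + ∑ (except f a)    ≡⟨ xy∙z≈xz∙y (f a) (g a) _ ⟩
  f a + ∑ (except f a) + g a    ≡⟨ cong (_+ g a) (sym (∑-except f a)) ⟩
  ∑ f + g a                     ∎
  where
  open ≡-Reasoning
  same : ∀ j → except g a j ≡ except f a j
  same j with j ≟ a
  ... | yes _ = refl
  ... | no j≢a = g≗f j j≢a

∑-≥ : (f : Fin n → ℕ) (a : Fin n) → f a ≤ ∑ f
∑-≥ f a = subst (f a ≤_) (sym (∑-except f a)) (m≤m+n (f a) _)

∑-≥₂ : (f : Fin n → ℕ) {a b : Fin n} → b ≢ a → f a + f b ≤ ∑ f
∑-≥₂ f {a} {b} b≢a = subst (f a + f b ≤_) (sym (∑-except f a))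
  (+-monoʳ-≤ (f a) (subst (_≤ ∑ (except f a)) (except-≢ f b≢a) (∑-≥ (except f a) b)))

∑-≥₃ : (f : Fin n → ℕ) {a b c : Fin n} → b ≢ a → c ≢ a → c ≢ b → f a + f b + f c ≤ ∑ f
∑-≥₃ f {a} {b} {c} b≢a c≢a c≢b = subst (f a + f b + f c ≤_) (sym (∑-except f a))
  (subst (_≤ f a + ∑ (except f a)) (sym (+-assoc (f a) (f b) (f c)))
  (+-monoʳ-≤ (f a) (subst₂ (λ s t → s + t ≤ ∑ (except f a)) (except-≢ f b≢a) (except-≢ f c≢a)
    (∑-≥₂ (except f a) c≢b))))

∑-positive : (f : Fin n → ℕ) → 0 < ∑ f → ∃ λ j → 0 < f j
∑-positive {suc n} f ∑>0 with f zero in fz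
... | suc _ = zero , subst (0 <_) (sym fz) (s≤s z≤n)
... | zero with ∑-positive (f ∘ suc) ∑>0
...   | j , fj>0 = suc j , fj>0

count : Bool → ℕ
count b = if b then 1 else 0

deg-∑ : (G : Graph n) (w : Fin n) → deg G w ≡ ∑ (count ∘ adj G w)
deg-∑ G w = sum-map-allFin (count ∘ adj G w)

module _ (G : Graph n) {w : Fin n} where

  private
    count-Adj : ∀ {a} → Adj G w a → count (adj G w a) ≡ 1
    count-Adj wa = cong count (Adj⇒≡true G wa)

  leaf-neighbour : deg G w ≡ 1 → ∀ {a b} → Adj G w a → Adj G w b → b ≡ a
  leaf-neighbour deg≡1 {a} {b} wa wb with b ≟ a
  ... | yes b≡a = b≡a
  ... | no b≢a = contradiction (subst₂ _≤_ (cong₂ _+_ (count-Adj wa) (count-Adj wb)) (trans (sym (deg-∑ G w)) deg≡1)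
                   (∑-≥₂ (count ∘ adj G w) b≢a)) λ { (s≤s ()) }

  deg2-neighbours : deg G w ≡ 2 → ∀ {a b c} → Adj G w a → Adj G w b → b ≢ a → Adj G w c → c ≡ a ⊎ c ≡ b
  deg2-neighbours deg≡2 {a} {b} {c} wa wb b≢a wc with c ≟ a | c ≟ b
  ... | yes c≡a | _ = inj₁ c≡a
  ... | no _ | yes c≡b = inj₂ c≡b
  ... | no c≢a | no c≢b = contradiction
    (subst₂ _≤_ (cong₂ _+_ (cong₂ _+_ (count-Adj wa) (count-Adj wb)) (count-Adj wc)) (trans (sym (deg-∑ G w)) deg≡2)
      (∑-≥₃ (count ∘ adj G w) b≢a c≢a c≢b)) λ { (s≤s (s≤s ())) }

  deg2-other-neighbour : deg G w ≡ 2 → ∀ {a} → Adj G w a → ∃ λ b → b ≢ a × Adj G w b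
  deg2-other-neighbour deg≡2 {a} wa = neighbour (∑-positive (except (count ∘ adj G w) a) rest-positive)
    where
    rest-positive : 0 < ∑ (except (count ∘ adj G w) a)
    rest-positive = +-cancelˡ-≤ 1 1 _ (≤-reflexive (begin
      2                                                   ≡⟨ sym deg≡2 ⟩
      deg G w                                             ≡⟨ deg-∑ G w ⟩
      ∑ (count ∘ adj G w)                                 ≡⟨ ∑-except (count ∘ adj G w) a ⟩
      count (adj G w a) + ∑ (except (count ∘ adj G w) a) ≡⟨ cong (_+ ∑ (except (count ∘ adj G w) a)) (count-Adj wa) ⟩
      1 + ∑ (except (count ∘ adj G w) a)                  ∎))
      where open ≡-Reasoning
    neighbour : (∃ λ b → 0 < except (count ∘ adj G w) a b) → ∃ λ b → b ≢ a × Adj G w b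
    neighbour (b , positive) with b ≟ a | adj G w b in wb
    ... | yes _ | _ = contradiction positive λ ()
    ... | no b≢a | true = b , b≢a , ≡true⇒Adj G wb
    ... | no _ | false = contradiction positive λ ()

filterᵇ-cong : {A : Set} {P Q : A → Bool} → (∀ a → P a ≡ Q a) → (xs : List A) → filterᵇ P xs ≡ filterᵇ Q xs
filterᵇ-cong P≗Q [] = refl
filterᵇ-cong {P = P} {Q} P≗Q (a ∷ xs) with P a | Q a | P≗Q a
... | true | .true | refl = cong (a ∷_) (filterᵇ-cong P≗Q xs)
... | false | .false | refl = filterᵇ-cong P≗Q xs

pendentCount-cong : (G H : Graph n) → (∀ w → deg H w ≡ deg G w) → pendentCount H ≡ pendentCount G
pendentCount-cong {n} G H same = cong length (filterᵇ-cong (λ w → cong isOne (same w)) (allFin n))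

-- Setting a single edge

SamePair : Fin n → Fin n → Fin n → Fin n → Set
SamePair p q i j = (i ≡ p × j ≡ q) ⊎ (i ≡ q × j ≡ p)

samePair? : (p q i j : Fin n) → Dec (SamePair p q i j)
samePair? p q i j = (i ≟ p ×-dec j ≟ q) ⊎-dec (i ≟ q ×-dec j ≟ p)

SamePair-swap : {p q i j : Fin n} → SamePair p q i j → SamePair p q j i
SamePair-swap (inj₁ (i≡p , j≡q)) = inj₂ (j≡q , i≡p)
SamePair-swap (inj₂ (i≡q , j≡p)) = inj₁ (j≡p , i≡q)

SamePair-loop : {p q i : Fin n} → p ≢ q → ¬ SamePair p q i i
SamePair-loop p≢q (inj₁ (i≡p , i≡q)) = p≢q (trans (sym i≡p) i≡q)
SamePair-loop p≢q (inj₂ (i≡q , i≡p)) = p≢q (trans (sym i≡p) i≡q)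

SamePair-unique : {p q i j k : Fin n} → p ≢ q → SamePair p q i j → SamePair p q i k → j ≡ k
SamePair-unique p≢q (inj₁ (_ , j≡q)) (inj₁ (_ , k≡q)) = trans j≡q (sym k≡q)
SamePair-unique p≢q (inj₂ (_ , j≡p)) (inj₂ (_ , k≡p)) = trans j≡p (sym k≡p)
SamePair-unique p≢q (inj₁ (i≡p , _)) (inj₂ (i≡q , _)) = ⊥-elim (p≢q (trans (sym i≡p) i≡q))
SamePair-unique p≢q (inj₂ (i≡q , _)) (inj₁ (i≡p , _)) = ⊥-elim (p≢q (trans (sym i≡p) i≡q))

¬SamePair : {p q i j : Fin n} → (i ≢ p ⊎ j ≢ q) → (i ≢ q ⊎ j ≢ p) → ¬ SamePair p q i j
¬SamePair (inj₁ i≢p) _ (inj₁ (i≡p , _)) = i≢p i≡p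
¬SamePair (inj₂ j≢q) _ (inj₁ (_ , j≡q)) = j≢q j≡q
¬SamePair _ (inj₁ i≢q) (inj₂ (i≡q , _)) = i≢q i≡q
¬SamePair _ (inj₂ j≢p) (inj₂ (_ , j≡p)) = j≢p j≡p

opaque
  setEdge : (G : Graph n) (p q : Fin n) → p ≢ q → Bool → Graph n
  setEdge G p q p≢q b = record
    { adj    = λ i j → if does (samePair? p q i j) then b else adj G i j
    ; sym    = λ i j → cong₂ (if_then b else_)
                 (does-⇔ (mk⇔ SamePair-swap SamePair-swap) (samePair? p q i j) (samePair? p q j i))
                 (Graph.sym G i j)
    ; irrefl = λ i → trans (cong (if_then b else adj G i i) (dec-false (samePair? p q i i) (SamePair-loop p≢q)))
                 (irrefl G i)
    }

opaque
  unfolding setEdge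

  setEdge-same : (G : Graph n) {p q : Fin n} (p≢q : p ≢ q) (b : Bool) {i j : Fin n} →
    SamePair p q i j → adj (setEdge G p q p≢q b) i j ≡ b
  setEdge-same G {p} {q} p≢q b {i} {j} s = cong (if_then b else adj G i j) (dec-true (samePair? p q i j) s)

  setEdge-other : (G : Graph n) {p q : Fin n} (p≢q : p ≢ q) (b : Bool) {i j : Fin n} →
    ¬ SamePair p q i j → adj (setEdge G p q p≢q b) i j ≡ adj G i j
  setEdge-other G {p} {q} p≢q b {i} {j} ¬s = cong (if_then b else adj G i j) (dec-false (samePair? p q i j) ¬s)

setEdge-keeps-true : (G : Graph n) {p q : Fin n} (p≢q : p ≢ q) {i j : Fin n} →
  adj G i j ≡ true → adj (setEdge G p q p≢q true) i j ≡ true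
setEdge-keeps-true G {p} {q} p≢q {i} {j} ij with samePair? p q i j
... | yes same = setEdge-same G p≢q true same
... | no other = trans (setEdge-other G p≢q true other) ij

deg-update : (G H : Graph n) (w a : Fin n) → (∀ j → j ≢ a → adj H w j ≡ adj G w j) →
  deg H w + count (adj G w a) ≡ deg G w + count (adj H w a)
deg-update G H w a H≗G = begin
  deg H w + count (adj G w a)              ≡⟨ cong (_+ count (adj G w a)) (deg-∑ H w) ⟩
  ∑ (count ∘ adj H w) + count (adj G w a)
    ≡⟨ ∑-update (count ∘ adj G w) (count ∘ adj H w) a (λ j j≢a → cong count (H≗G j j≢a)) ⟩
  ∑ (count ∘ adj G w) + count (adj H w a)  ≡⟨ cong (_+ count (adj H w a)) (deg-∑ G w) ⟨
  deg G w + count (adj H w a)              ∎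
  where open ≡-Reasoning

module _ (G : Graph n) {p q : Fin n} (p≢q : p ≢ q) (b : Bool) where

  deg-setEdge-end : {w w′ : Fin n} → SamePair p q w w′ →
    deg (setEdge G p q p≢q b) w + count (adj G w w′) ≡ deg G w + count b
  deg-setEdge-end {w} {w′} ww′ = trans
    (deg-update G (setEdge G p q p≢q b) w w′
      (λ j j≢w′ → setEdge-other G p≢q b (λ wj → j≢w′ (SamePair-unique p≢q wj ww′))))
    (cong (λ c → deg G w + count c) (setEdge-same G p≢q b ww′))

  deg-setEdge-far : {w : Fin n} → w ≢ p → w ≢ q → deg (setEdge G p q p≢q b) w ≡ deg G w
  deg-setEdge-far {w} w≢p w≢q = cong sum (map-cong (λ j → cong count (setEdge-other G p≢q b far)) (allFin n))
    where
    far : ∀ {j} → ¬ SamePair p q w j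
    far (inj₁ (w≡p , _)) = w≢p w≡p
    far (inj₂ (w≡q , _)) = w≢q w≡q

endpoints : Fin n → Fin n → Fin n → ℕ
endpoints p q w = count (does (w ≟ p)) + count (does (w ≟ q))

endpoints-first : {p q : Fin n} → p ≢ q → endpoints p q p ≡ 1
endpoints-first {p = p} {q} p≢q = cong₂ _+_ (cong count (dec-true (p ≟ p) refl)) (cong count (dec-false (p ≟ q) p≢q))

endpoints-second : {p q : Fin n} → p ≢ q → endpoints p q q ≡ 1
endpoints-second {p = p} {q} p≢q = cong₂ _+_ (cong count (dec-false (q ≟ p) (p≢q ∘ sym))) (cong count (dec-true (q ≟ q) refl))

endpoints-far : {p q w : Fin n} → w ≢ p → w ≢ q → endpoints p q w ≡ 0
endpoints-far {p = p} {q} {w} w≢p w≢q = cong₂ _+_ (cong count (dec-false (w ≟ p) w≢p)) (cong count (dec-false (w ≟ q) w≢q))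

module _ (G : Graph n) {p q : Fin n} (p≢q : p ≢ q) where

  deg-setEdge : ∀ b w → deg (setEdge G p q p≢q b) w + count (adj G p q) * endpoints p q w
                       ≡ deg G w + count b * endpoints p q w
  deg-setEdge b w = by-cases (w ≟ p) (w ≟ q)
    where
    Goal : Fin n → Set
    Goal w = deg (setEdge G p q p≢q b) w + count (adj G p q) * endpoints p q w ≡ deg G w + count b * endpoints p q w
    at-end : ∀ {w w′} → SamePair p q w w′ → endpoints p q w ≡ 1 → adj G w w′ ≡ adj G p q → Goal w
    at-end ww′ one same-edge rewrite one | *-identityʳ (count (adj G p q)) | *-identityʳ (count b) | sym same-edge =
      deg-setEdge-end G p≢q b ww′
    by-cases : Dec (w ≡ p) → Dec (w ≡ q) → Goal w
    by-cases (yes w≡p) _ = subst Goal (sym w≡p) (at-end (inj₁ (refl , refl)) (endpoints-first p≢q) refl)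
    by-cases (no _) (yes w≡q) = subst Goal (sym w≡q) (at-end (inj₂ (refl , refl)) (endpoints-second p≢q) (Graph.sym G q p))
    by-cases (no w≢p) (no w≢q) rewrite endpoints-far w≢p w≢q | *-zeroʳ (count (adj G p q)) | *-zeroʳ (count b) =
      cong (_+ 0) (deg-setEdge-far G p≢q b w≢p w≢q)

  deg-removeEdge : adj G p q ≡ true → ∀ w → deg (setEdge G p q p≢q false) w + endpoints p q w ≡ deg G w
  deg-removeEdge pq w = begin
    deg H w + e                         ≡⟨ cong (deg H w +_) (sym (+-identityʳ e)) ⟩
    deg H w + count true * e            ≡⟨ cong (λ c → deg H w + count c * e) (sym pq) ⟩
    deg H w + count (adj G p q) * e     ≡⟨ deg-setEdge false w ⟩
    deg G w + 0                         ≡⟨ +-identityʳ (deg G w) ⟩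
    deg G w                             ∎
    where
    open ≡-Reasoning
    H = setEdge G p q p≢q false
    e = endpoints p q w

  deg-addEdge : adj G p q ≡ false → ∀ w → deg (setEdge G p q p≢q true) w ≡ deg G w + endpoints p q w
  deg-addEdge pq w = begin
    deg H w                             ≡⟨ sym (+-identityʳ (deg H w)) ⟩
    deg H w + count false * e           ≡⟨ cong (λ c → deg H w + count c * e) (sym pq) ⟩
    deg H w + count (adj G p q) * e     ≡⟨ deg-setEdge true w ⟩
    deg G w + (e + 0)                   ≡⟨ cong (deg G w +_) (+-identityʳ e) ⟩
    deg G w + e                         ∎
    where
    open ≡-Reasoning
    H = setEdge G p q p≢q true
    e = endpoints p q w

-- Edge sums

sum-concat : (xss : List (List ℕ)) → sum (concat xss) ≡ sum (map sum xss)
sum-concat [] = refl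
sum-concat (xs ∷ xss) = trans (sum-++ xs (concat xss)) (cong (sum xs +_) (sum-concat xss))

sum-filterᵇ : {A : Set} (P : A → Bool) (f : A → ℕ) (xs : List A) →
  sum (map f (filterᵇ P xs)) ≡ sum (map (λ x → if P x then f x else 0) xs)
sum-filterᵇ P f [] = refl
sum-filterᵇ P f (x ∷ xs) with P x
... | true = cong (f x +_) (sum-filterᵇ P f xs)
... | false = sum-filterᵇ P f xs

sum-map-suc : {A : Set} (f : A → ℕ) (xs : List A) → sum (map (suc ∘ f) xs) ≡ sum (map f xs) + length xs
sum-map-suc f [] = refl
sum-map-suc f (x ∷ xs) = trans (cong (λ s → suc (f x + s)) (sum-map-suc f xs))
  (trans (cong suc (sym (+-assoc (f x) (sum (map f xs)) (length xs)))) (sym (+-suc (f x + sum (map f xs)) (length xs))))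

∑∑ : (Fin n → Fin n → ℕ) → ℕ
∑∑ f = ∑ (λ i → ∑ (f i))

edgeWeight : Graph n → (Fin n × Fin n → ℕ) → Fin n → Fin n → ℕ
edgeWeight G F i j = if (toℕ i <ᵇ toℕ j) ∧ adj G i j then F (i , j) else 0

sum-edges : (G : Graph n) (F : Fin n × Fin n → ℕ) → sum (map F (edges G)) ≡ ∑∑ (edgeWeight G F)
sum-edges {n} G F = begin
  sum (map F (concat (map row (allFin n))))           ≡⟨ cong sum (sym (concat-map (map row (allFin n)))) ⟩
  sum (concat (map (map F) (map row (allFin n))))     ≡⟨ sum-concat (map (map F) (map row (allFin n))) ⟩
  sum (map sum (map (map F) (map row (allFin n))))    ≡⟨ cong sum (sym (trans (map-∘ {g = sum} (allFin n)) (cong (map sum) (map-∘ (allFin n))))) ⟩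
  sum (map (λ i → sum (map F (row i))) (allFin n))    ≡⟨ sum-map-allFin (λ i → sum (map F (row i))) ⟩
  ∑ (λ i → sum (map F (row i)))                       ≡⟨ ∑-cong (λ i → trans (cong sum (sym (map-∘ {g = F} (filterᵇ (P i) (allFin n)))))
                                                           (trans (sum-filterᵇ (P i) (λ j → F (i , j)) (allFin n))
                                                             (sum-map-allFin (edgeWeight G F i)))) ⟩
  ∑∑ (edgeWeight G F)                                 ∎
  where
  open ≡-Reasoning
  P : Fin n → Fin n → Bool
  P i j = (toℕ i <ᵇ toℕ j) ∧ adj G i j
  row : Fin n → List (Fin n × Fin n)
  row i = map (i ,_) (filterᵇ (P i) (allFin n))

∑∑-update : (f g : Fin n → Fin n → ℕ) (a c : Fin n) → (∀ i j → ¬ (i ≡ a × j ≡ c) → g i j ≡ f i j) →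
  ∑∑ g + f a c ≡ ∑∑ f + g a c
∑∑-update f g a c g≗f = +-cancelʳ-≡ (∑ (f a)) _ _ (begin
  ∑∑ g + f a c + ∑ (f a)       ≡⟨ xy∙z≈xz∙y (∑∑ g) (f a c) (∑ (f a)) ⟩
  ∑∑ g + ∑ (f a) + f a c       ≡⟨ cong (_+ f a c) rows ⟩
  ∑∑ f + ∑ (g a) + f a c       ≡⟨ +-assoc (∑∑ f) (∑ (g a)) (f a c) ⟩
  ∑∑ f + (∑ (g a) + f a c)     ≡⟨ cong (∑∑ f +_) row-a ⟩
  ∑∑ f + (∑ (f a) + g a c)     ≡⟨ cong (∑∑ f +_) (+-comm (∑ (f a)) (g a c)) ⟩
  ∑∑ f + (g a c + ∑ (f a))     ≡⟨ +-assoc (∑∑ f) (g a c) (∑ (f a)) ⟨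
  ∑∑ f + g a c + ∑ (f a)       ∎)
  where
  open ≡-Reasoning
  row-a : ∑ (g a) + f a c ≡ ∑ (f a) + g a c
  row-a = ∑-update (f a) (g a) c (λ j j≢c → g≗f a j (λ (_ , j≡c) → j≢c j≡c))
  rows : ∑∑ g + ∑ (f a) ≡ ∑∑ f + ∑ (g a)
  rows = ∑-update (λ i → ∑ (f i)) (λ i → ∑ (g i)) a (λ i i≢a → ∑-cong (λ j → g≗f i j (λ (i≡a , _) → i≢a i≡a)))

SamePair-flip : {p q a c i j : Fin n} → SamePair p q a c → SamePair p q i j → ¬ (i ≡ a × j ≡ c) → i ≡ c × j ≡ a
SamePair-flip (inj₁ (a≡p , c≡q)) (inj₁ (i≡p , j≡q)) ¬same = ⊥-elim (¬same (trans i≡p (sym a≡p) , trans j≡q (sym c≡q)))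
SamePair-flip (inj₁ (a≡p , c≡q)) (inj₂ (i≡q , j≡p)) _ = trans i≡q (sym c≡q) , trans j≡p (sym a≡p)
SamePair-flip (inj₂ (a≡q , c≡p)) (inj₁ (i≡p , j≡q)) _ = trans i≡p (sym c≡p) , trans j≡q (sym a≡q)
SamePair-flip (inj₂ (a≡q , c≡p)) (inj₂ (i≡q , j≡p)) ¬same = ⊥-elim (¬same (trans i≡q (sym a≡q) , trans j≡p (sym c≡p)))

SamePair-symmetric : {A : Set} (h : Fin n → Fin n → A) → (∀ i j → h i j ≡ h j i) →
  {p q a c : Fin n} → SamePair p q a c → h a c ≡ h p q
SamePair-symmetric h h-sym (inj₁ (refl , refl)) = refl
SamePair-symmetric h h-sym (inj₂ (refl , refl)) = h-sym _ _

edgeWeight-forward : (G : Graph n) (F : Fin n × Fin n → ℕ) {i j : Fin n} → toℕ i < toℕ j →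
  edgeWeight G F i j ≡ (if adj G i j then F (i , j) else 0)
edgeWeight-forward G F {i} {j} i<j with toℕ i <ᵇ toℕ j | <⇒<ᵇ i<j
... | true | _ = refl

edgeWeight-backward : (G : Graph n) (F : Fin n × Fin n → ℕ) {i j : Fin n} → toℕ j < toℕ i → edgeWeight G F i j ≡ 0
edgeWeight-backward G F {i} {j} j<i with toℕ i <ᵇ toℕ j in i<ᵇj
... | false = refl
... | true = ⊥-elim (<-asym j<i (<ᵇ⇒< (toℕ i) (toℕ j) (subst T (sym i<ᵇj) _)))

module _ (G : Graph n) (F : Fin n × Fin n → ℕ) (F-sym : ∀ i j → F (i , j) ≡ F (j , i))
         {p q : Fin n} (p≢q : p ≢ q) (b : Bool) where

  private
    H = setEdge G p q p≢q b

    oriented : {a c : Fin n} → SamePair p q a c → toℕ a < toℕ c →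
      ∑∑ (edgeWeight H F) + (if adj G p q then F (p , q) else 0) ≡ ∑∑ (edgeWeight G F) + (if b then F (p , q) else 0)
    oriented {a} {c} ac a<c = subst₂ (λ s t → ∑∑ (edgeWeight H F) + s ≡ ∑∑ (edgeWeight G F) + t)
      (trans (edgeWeight-forward G F a<c) (cong₂ (if_then_else 0) (SamePair-symmetric (adj G) (Graph.sym G) ac)
                                                            (SamePair-symmetric (λ i j → F (i , j)) F-sym ac)))
      (trans (edgeWeight-forward H F a<c) (cong₂ (if_then_else 0) (setEdge-same G p≢q b ac)
                                                            (SamePair-symmetric (λ i j → F (i , j)) F-sym ac)))
      (∑∑-update (edgeWeight G F) (edgeWeight H F) a c unchanged)
      where
      unchanged : ∀ i j → ¬ (i ≡ a × j ≡ c) → edgeWeight H F i j ≡ edgeWeight G F i j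
      unchanged i j ¬ac with samePair? p q i j
      ... | no ¬pq = cong (λ e → if (toℕ i <ᵇ toℕ j) ∧ e then F (i , j) else 0) (setEdge-other G p≢q b ¬pq)
      ... | yes pq with SamePair-flip ac pq ¬ac
      ...   | refl , refl = trans (edgeWeight-backward H F a<c) (sym (edgeWeight-backward G F a<c))

  edgeSum-setEdge : ∑∑ (edgeWeight H F) + (if adj G p q then F (p , q) else 0)
                    ≡ ∑∑ (edgeWeight G F) + (if b then F (p , q) else 0)
  edgeSum-setEdge with <-cmp (toℕ p) (toℕ q)
  ... | tri< p<q _ _ = oriented (inj₁ (refl , refl)) p<q
  ... | tri≈ _ p≡q _ = ⊥-elim (p≢q (toℕ-injective p≡q))
  ... | tri> _ _ q<p = oriented (inj₂ (refl , refl)) q<p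

module _ (G : Graph n) (F : Fin n × Fin n → ℕ) (F-sym : ∀ i j → F (i , j) ≡ F (j , i)) {p q : Fin n} (p≢q : p ≢ q) where

  edgeSum-removeEdge : adj G p q ≡ true → ∑∑ (edgeWeight (setEdge G p q p≢q false) F) + F (p , q) ≡ ∑∑ (edgeWeight G F)
  edgeSum-removeEdge pq = trans (cong (λ c → ∑∑ (edgeWeight (setEdge G p q p≢q false) F) + (if c then F (p , q) else 0)) (sym pq))
    (trans (edgeSum-setEdge G F F-sym p≢q false) (+-identityʳ _))

  edgeSum-addEdge : adj G p q ≡ false → ∑∑ (edgeWeight (setEdge G p q p≢q true) F) ≡ ∑∑ (edgeWeight G F) + F (p , q)
  edgeSum-addEdge pq = trans (sym (+-identityʳ _))
    (trans (cong (λ c → ∑∑ (edgeWeight (setEdge G p q p≢q true) F) + (if c then F (p , q) else 0)) (sym pq))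
      (edgeSum-setEdge G F F-sym p≢q true))

record EdgeAdditive (Φ : Graph n → ℕ) (φ : Fin n → Fin n → ℕ) : Set where
  field
    remove : ∀ H {p q} (p≢q : p ≢ q) → adj H p q ≡ true → Φ (setEdge H p q p≢q false) + φ p q ≡ Φ H
    add    : ∀ H {p q} (p≢q : p ≢ q) → adj H p q ≡ false → Φ (setEdge H p q p≢q true) ≡ Φ H + φ p q

deg-additive : (w : Fin n) → EdgeAdditive (λ H → deg H w) (λ p q → endpoints p q w)
deg-additive w = record
  { remove = λ H p≢q pq → deg-removeEdge H p≢q pq w
  ; add    = λ H p≢q pq → deg-addEdge H p≢q pq w }

edgeSum-additive : (F : Fin n × Fin n → ℕ) → (∀ i j → F (i , j) ≡ F (j , i)) →
  EdgeAdditive (λ H → ∑∑ (edgeWeight H F)) (λ p q → F (p , q))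
edgeSum-additive F F-sym = record
  { remove = λ H p≢q → edgeSum-removeEdge H F F-sym p≢q
  ; add    = λ H p≢q → edgeSum-addEdge H F F-sym p≢q }

-- Walks and cycles

_++ʷ_ : {a b c : Fin n} → Walk G a b → Walk G b c → Walk G a c
here ++ʷ w′ = w′
step e w ++ʷ w′ = step e (w ++ʷ w′)

reverseʷ : {a b : Fin n} → Walk G a b → Walk G b a
reverseʷ here = here
reverseʷ {G = G} (step e w) = reverseʷ w ++ʷ step (Adj-sym G e) here

CycleAt : Graph n → Fin n → List (Fin n) → Set
CycleAt G c cs = (2 ≤ length cs) × Unique (c ∷ cs) × Linked (Adj G) (c ∷ cs ++ c ∷ [])

module _ {A : Set} {R : A → A → Set} where

  Linked-∷ʳ : ∀ xs {a b} → Linked R (xs ∷ʳ a) → R a b → Linked R (xs ∷ʳ a ∷ʳ b)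
  Linked-∷ʳ [] [-] r = r ∷ [-]
  Linked-∷ʳ (x ∷ []) (r₁ ∷ [-]) r = r₁ ∷ r ∷ [-]
  Linked-∷ʳ (x ∷ y ∷ xs) (r₁ ∷ rs) r = r₁ ∷ Linked-∷ʳ (y ∷ xs) rs r

  Linked-∷ʳ⁻ : ∀ xs {a b} → Linked R (xs ∷ʳ a ∷ʳ b) → Linked R (xs ∷ʳ a) × R a b
  Linked-∷ʳ⁻ [] (r ∷ [-]) = [-] , r
  Linked-∷ʳ⁻ (x ∷ []) (r₁ ∷ r ∷ [-]) = (r₁ ∷ [-]) , r
  Linked-∷ʳ⁻ (x ∷ y ∷ xs) (r₁ ∷ rs) with Linked-∷ʳ⁻ (y ∷ xs) rs
  ... | rs′ , r = (r₁ ∷ rs′) , r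

  Linked-restrict : {R′ : A → A → Set} {P : A → Set} → (∀ {a b} → P a → P b → R a b → R′ a b) →
    ∀ {xs} → All P xs → Linked R xs → Linked R′ xs
  Linked-restrict f [] [] = []
  Linked-restrict f (_ ∷ []) [-] = [-]
  Linked-restrict f (pa ∷ pb ∷ ps) (r ∷ rs) = f pa pb r ∷ Linked-restrict f (pb ∷ ps) rs

Unique-∷ʳ : {A : Set} {xs : List A} {c : A} → Unique xs → All (_≢ c) xs → Unique (xs ∷ʳ c)
Unique-∷ʳ [] [] = [] ∷ []
Unique-∷ʳ (x∉ ∷ u) (x≢c ∷ ≢c) = ∷ʳ⁺ x∉ x≢c ∷ Unique-∷ʳ u ≢c

CycleAt-rotate : {c d : Fin n} {cs : List (Fin n)} → CycleAt G c (d ∷ cs) → CycleAt G d (cs ∷ʳ c)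
CycleAt-rotate {cs = []} (s≤s () , _)
CycleAt-rotate {c = c} {d} {cs = e ∷ es} (_ , (c∉ ∷ (d∉ ∷ u)) , lk) =
  s≤s (subst (1 ≤_) (sym (length-++-sucʳ es c [])) (s≤s z≤n)) ,
  (∷ʳ⁺ d∉ (≢-sym (All.head c∉)) ∷ Unique-∷ʳ u (All.map ≢-sym (All.tail c∉))) ,
  Linked-∷ʳ (d ∷ e ∷ es) (Linked.tail lk) (Linked.head lk)

CycleAt-rotateTo : {c : Fin n} (pre : List (Fin n)) (w : Fin n) (post : List (Fin n)) →
  CycleAt G c (pre ++ w ∷ post) → CycleAt G w (post ++ c ∷ pre)
CycleAt-rotateTo {G = G} [] w post cyc = CycleAt-rotate {G = G} cyc
CycleAt-rotateTo {G = G} {c = c} (p ∷ pre) w post cyc =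
  subst (CycleAt G w) (++-assoc post (c ∷ []) (p ∷ pre))
    (CycleAt-rotateTo {G = G} pre w (post ∷ʳ c) (subst (CycleAt G p) (++-assoc pre (w ∷ post) (c ∷ [])) (CycleAt-rotate {G = G} cyc)))

CycleAt-through : {c w : Fin n} {cs : List (Fin n)} → CycleAt G c cs → w ∈ c ∷ cs → ∃ (CycleAt G w)
CycleAt-through {cs = cs} cyc (here refl) = cs , cyc
CycleAt-through {G = G} {c = c} cyc (there w∈cs) with ∈-∃++ w∈cs
... | pre , post , refl = post ++ c ∷ pre , CycleAt-rotateTo {G = G} pre _ post cyc

record CycleView (G : Graph n) (w : Fin n) (cs : List (Fin n)) : Set where
  field
    first last : Fin n
    middle : List (Fin n)
    shape : cs ≡ first ∷ (middle ∷ʳ last)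
    w-first : Adj G w first
    path : Linked (Adj G) (first ∷ (middle ∷ʳ last))
    last-w : Adj G last w
    first≢last : first ≢ last

viewCycle : {w : Fin n} {cs : List (Fin n)} → CycleAt G w cs → CycleView G w cs
viewCycle {cs = []} (() , _)
viewCycle {cs = a ∷ rest} cyc with initLast rest
viewCycle {cs = a ∷ .[]} (s≤s () , _) | []
viewCycle {G = G} {w = w} {cs = a ∷ .(mid ∷ʳ b)} (_ , (_ ∷ (a∉ ∷ _)) , lk) | mid ∷ʳ′ b = record
  { first = a ; last = b ; middle = mid ; shape = refl
  ; w-first = Linked.head lk
  ; path = proj₁ (Linked-∷ʳ⁻ (a ∷ mid) (Linked.tail lk))
  ; last-w = proj₂ (Linked-∷ʳ⁻ (a ∷ mid) (Linked.tail lk))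
  ; first≢last = proj₂ (∷ʳ⁻ a∉) }

module _ {w : Fin n} {cs : List (Fin n)} (V : CycleView G w cs) where
  open CycleView V

  CycleView-first∈ : first ∈ w ∷ cs
  CycleView-first∈ = there (subst (first ∈_) (sym shape) (here refl))

  CycleView-last∈ : last ∈ w ∷ cs
  CycleView-last∈ = there (subst (last ∈_) (sym shape) (there (∈-++⁺ʳ middle (here refl))))

module _ {c : Fin n} {cs : List (Fin n)} where

  leaf-∉-cycle : {w a : Fin n} → (∀ {j} → Adj G w j → j ≡ a) → CycleAt G c cs → w ∉ c ∷ cs
  leaf-∉-cycle {G = G} nbr cyc w∈ with CycleAt-through {G = G} cyc w∈
  ... | _ , cyc′ = first≢last (trans (nbr w-first) (sym (nbr (Adj-sym G last-w))))
    where open CycleView (viewCycle {G = G} cyc′)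

  ∉-cycle-if-neighbours : {w a b : Fin n} → (∀ {j} → Adj G w j → j ≡ a ⊎ j ≡ b) →
    (∀ {c′ cs′} → CycleAt G c′ cs′ → b ∉ c′ ∷ cs′) → CycleAt G c cs → w ∉ c ∷ cs
  ∉-cycle-if-neighbours {G = G} nbrs b-off cyc w∈ with CycleAt-through {G = G} cyc w∈
  ... | cs′ , cyc′ = two-neighbours (viewCycle {G = G} cyc′)
    where
    two-neighbours : CycleView G _ cs′ → ⊥
    two-neighbours V with nbrs (CycleView.w-first V) | nbrs (Adj-sym G (CycleView.last-w V))
    ... | inj₁ first≡a | inj₁ last≡a = CycleView.first≢last V (trans first≡a (sym last≡a))
    ... | inj₂ first≡b | _ = b-off cyc′ (subst (_∈ _) first≡b (CycleView-first∈ V))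
    ... | _ | inj₂ last≡b = b-off cyc′ (subst (_∈ _) last≡b (CycleView-last∈ V))

CycleAt-restrict : {H : Graph n} {P : Fin n → Set} → (∀ {a b} → P a → P b → Adj H a b → Adj G a b) →
  {c : Fin n} {cs : List (Fin n)} → All P (c ∷ cs) → CycleAt H c cs → CycleAt G c cs
CycleAt-restrict H⇒G all-P (len , uniq , lk) = len , uniq , Linked-restrict H⇒G (∷ʳ⁺ all-P (All.head all-P)) lk

-- The relocation of y

cancel-gap : ∀ {W S m Z a b c e} → W + (suc a + Z + suc b) ≡ S + m + (Z + suc c + suc e) → m + c + e < a + b → W < S
cancel-gap {W} {S} {m} {Z} {a} {b} {c} {e} eq gap = +-cancelʳ-< (2 + Z + (a + b)) W S (begin-strict
  W + (2 + Z + (a + b))         ≡⟨ lhs W Z a b ⟩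
  W + (suc a + Z + suc b)       ≡⟨ eq ⟩
  S + m + (Z + suc c + suc e)   ≡⟨ rhs S m Z c e ⟩
  S + (2 + Z + (m + c + e))     <⟨ +-monoʳ-< S (+-monoʳ-< (2 + Z) gap) ⟩
  S + (2 + Z + (a + b))         ∎)
  where
  open ≤-Reasoning
  lhs : ∀ W Z a b → W + (2 + Z + (a + b)) ≡ W + (suc a + Z + suc b)
  lhs = solve-∀
  rhs : ∀ S m Z c e → S + m + (Z + suc c + suc e) ≡ S + (2 + Z + (m + c + e))
  rhs = solve-∀

module Relocation {n : ℕ} (G : Graph n) (acyclic : ¬ Cycle G)
  {x y z : Fin n} (xy : Adj G x y) (yz : Adj G y z) (z≢x : z ≢ x) (deg-x : deg G x ≡ 2) (deg-y : deg G y ≡ 2)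
  {u v : Fin n} (uv : Adj G u v) (deg-u : 3 ≤ deg G u) (deg-v : deg G v ≡ 1) where

  x≢y : x ≢ y
  x≢y = Adj⇒≢ G xy

  y≢z : y ≢ z
  y≢z = Adj⇒≢ G yz

  x≢z : x ≢ z
  x≢z = ≢-sym z≢x

  u≢v : u ≢ v
  u≢v = Adj⇒≢ G uv

  deg-≢ : ∀ {a b} → deg G a ≢ deg G b → a ≢ b
  deg-≢ d≢ refl = d≢ refl

  u≢x : u ≢ x
  u≢x = deg-≢ λ d≡ → contradiction (subst (3 ≤_) (trans d≡ deg-x) deg-u) λ { (s≤s (s≤s ())) }

  u≢y : u ≢ y
  u≢y = deg-≢ λ d≡ → contradiction (subst (3 ≤_) (trans d≡ deg-y) deg-u) λ { (s≤s (s≤s ())) }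

  v≢x : v ≢ x
  v≢x = deg-≢ λ d≡ → contradiction (trans (sym deg-v) (trans d≡ deg-x)) λ ()

  v≢y : v ≢ y
  v≢y = deg-≢ λ d≡ → contradiction (trans (sym deg-v) (trans d≡ deg-y)) λ ()

  v-neighbour : ∀ {j} → Adj G v j → j ≡ u
  v-neighbour = leaf-neighbour G deg-v (Adj-sym G uv)

  y-neighbours : ∀ {j} → Adj G y j → j ≡ x ⊎ j ≡ z
  y-neighbours = deg2-neighbours G deg-y (Adj-sym G xy) yz z≢x

  v≢z : v ≢ z
  v≢z refl = u≢y (sym (v-neighbour (Adj-sym G yz)))

  x-z-nonadjacent : adj G x z ≡ false
  x-z-nonadjacent with adj G x z in xz
  ... | false = refl
  ... | true = ⊥-elim (acyclic (x , y ∷ z ∷ [] , s≤s (s≤s z≤n) ,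
                 (x≢y ∷ x≢z ∷ []) ∷ (y≢z ∷ []) ∷ [] ∷ [] ,
                 xy ∷ yz ∷ Adj-sym G (≡true⇒Adj G xz) ∷ [-]))

  G₁ G₂ G₃ G₄ G₅ T′ : Graph n
  G₁ = setEdge G  x y x≢y false
  G₂ = setEdge G₁ y z y≢z false
  G₃ = setEdge G₂ x z x≢z true
  G₄ = setEdge G₃ u v u≢v false
  G₅ = setEdge G₄ u y u≢y true
  T′ = setEdge G₅ y v (≢-sym v≢y) true

  G₂-agrees : ∀ {i j} → ¬ SamePair x y i j → ¬ SamePair y z i j → adj G₂ i j ≡ adj G i j
  G₂-agrees ¬xy ¬yz = trans (setEdge-other G₁ y≢z false ¬yz) (setEdge-other G x≢y false ¬xy)

  T′-agrees-G₃ : ∀ {i j} → ¬ SamePair u v i j → ¬ SamePair u y i j → ¬ SamePair y v i j → adj T′ i j ≡ adj G₃ i j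
  T′-agrees-G₃ ¬uv ¬uy ¬yv = trans (setEdge-other G₅ (≢-sym v≢y) true ¬yv)
    (trans (setEdge-other G₄ u≢y true ¬uy) (setEdge-other G₃ u≢v false ¬uv))

  T′-agrees-G₂ : ∀ {i j} → ¬ SamePair x z i j → ¬ SamePair u v i j → ¬ SamePair u y i j → ¬ SamePair y v i j →
    adj T′ i j ≡ adj G₂ i j
  T′-agrees-G₂ ¬xz ¬uv ¬uy ¬yv = trans (T′-agrees-G₃ ¬uv ¬uy ¬yv) (setEdge-other G₂ x≢z true ¬xz)

  y-isolated₂ : ∀ j → adj G₂ y j ≡ false
  y-isolated₂ j with j ≟ x | j ≟ z
  ... | yes refl | _ = trans (setEdge-other G₁ y≢z false (¬SamePair (inj₂ x≢z) (inj₁ y≢z)))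
                             (setEdge-same G x≢y false (inj₂ (refl , refl)))
  ... | no _ | yes refl = setEdge-same G₁ y≢z false (inj₁ (refl , refl))
  ... | no j≢x | no j≢z = trans (G₂-agrees (¬SamePair (inj₁ (≢-sym x≢y)) (inj₂ j≢x)) (¬SamePair (inj₂ j≢z) (inj₁ y≢z)))
                            (¬Adj⇒≡false G λ yj → [ j≢x , j≢z ]′ (y-neighbours yj))

  v-isolated₄ : ∀ j → adj G₄ v j ≡ false
  v-isolated₄ j with j ≟ u
  ... | yes refl = setEdge-same G₃ u≢v false (inj₂ (refl , refl))
  ... | no j≢u = trans (setEdge-other G₃ u≢v false (¬SamePair (inj₁ (≢-sym u≢v)) (inj₂ j≢u)))
                   (trans (setEdge-other G₂ x≢z true (¬SamePair (inj₁ v≢x) (inj₁ v≢z)))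
                   (trans (G₂-agrees (¬SamePair (inj₁ v≢x) (inj₁ v≢y)) (¬SamePair (inj₁ v≢y) (inj₁ v≢z)))
                     (¬Adj⇒≡false G λ vj → j≢u (v-neighbour vj))))

  xy-present : adj G x y ≡ true
  xy-present = Adj⇒≡true G xy

  yz-present₁ : adj G₁ y z ≡ true
  yz-present₁ = trans (setEdge-other G x≢y false (¬SamePair (inj₁ (≢-sym x≢y)) (inj₂ z≢x))) (Adj⇒≡true G yz)

  xz-absent₂ : adj G₂ x z ≡ false
  xz-absent₂ = trans (G₂-agrees (¬SamePair (inj₂ (≢-sym y≢z)) (inj₁ x≢y)) (¬SamePair (inj₁ x≢y) (inj₁ x≢z))) x-z-nonadjacent

  uv-present₃ : adj G₃ u v ≡ true
  uv-present₃ = trans (setEdge-other G₂ x≢z true (¬SamePair (inj₁ u≢x) (inj₂ v≢x)))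
    (trans (G₂-agrees (¬SamePair (inj₁ u≢x) (inj₁ u≢y)) (¬SamePair (inj₁ u≢y) (inj₂ v≢y))) (Adj⇒≡true G uv))

  uy-absent₄ : adj G₄ u y ≡ false
  uy-absent₄ = trans (setEdge-other G₃ u≢v false (¬SamePair (inj₂ (≢-sym v≢y)) (inj₁ u≢v)))
    (trans (setEdge-other G₂ x≢z true (¬SamePair (inj₁ u≢x) (inj₂ (≢-sym x≢y))))
    (trans (Graph.sym G₂ u y) (y-isolated₂ u)))

  yv-absent₅ : adj G₅ y v ≡ false
  yv-absent₅ = trans (setEdge-other G₄ u≢y true (¬SamePair (inj₁ (≢-sym u≢y)) (inj₂ (≢-sym u≢v))))
    (trans (Graph.sym G₄ y v) (v-isolated₄ y))

  balance : ∀ {Φ φ} → EdgeAdditive Φ φ → Φ T′ + (φ x y + φ y z + φ u v) ≡ Φ G + (φ x z + φ u y + φ y v)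
  balance additive = telescope
    (remove G x≢y xy-present) (remove G₁ y≢z yz-present₁) (add G₂ x≢z xz-absent₂)
    (remove G₃ u≢v uv-present₃) (add G₄ u≢y uy-absent₄) (add G₅ (≢-sym v≢y) yv-absent₅)
    where
    open EdgeAdditive additive
    telescope : ∀ {d₀ d₁ d₂ d₃ d₄ d₅ d₆ r₁ r₂ a₃ r₄ a₅ a₆} →
      d₁ + r₁ ≡ d₀ → d₂ + r₂ ≡ d₁ → d₃ ≡ d₂ + a₃ → d₄ + r₄ ≡ d₃ → d₅ ≡ d₄ + a₅ → d₆ ≡ d₅ + a₆ →
      d₆ + (r₁ + r₂ + r₄) ≡ d₀ + (a₃ + a₅ + a₆)
    telescope {d₂ = d₂} {d₄ = d₄} {r₁ = r₁} {r₂} {a₃} {r₄} {a₅} {a₆} refl refl s₃ s₄ refl refl =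
      trans (regroup₁ d₄ r₁ r₂ r₄ a₅ a₆) (trans (cong (_+ (r₁ + r₂ + a₅ + a₆)) (trans s₄ s₃)) (regroup₂ d₂ r₁ r₂ a₃ a₅ a₆))
      where
      regroup₁ : ∀ d₄ r₁ r₂ r₄ a₅ a₆ → d₄ + a₅ + a₆ + (r₁ + r₂ + r₄) ≡ d₄ + r₄ + (r₁ + r₂ + a₅ + a₆)
      regroup₁ = solve-∀
      regroup₂ : ∀ d₂ r₁ r₂ a₃ a₅ a₆ → d₂ + a₃ + (r₁ + r₂ + a₅ + a₆) ≡ d₂ + r₂ + r₁ + (a₃ + a₅ + a₆)
      regroup₂ = solve-∀

  deg-preserved : ∀ w → deg T′ w ≡ deg G w
  deg-preserved w = +-cancelʳ-≡ (e x z + e u y + e y v) _ _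
    (trans (cong (deg T′ w +_) (sym (regroup (δ x) (δ y) (δ z) (δ u) (δ v)))) (balance (deg-additive w)))
    where
    e : Fin n → Fin n → ℕ
    e p q = endpoints p q w
    δ : Fin n → ℕ
    δ p = count (does (w ≟ p))
    regroup : ∀ a b c d e → a + b + (b + c) + (d + e) ≡ a + c + (d + b) + (b + e)
    regroup = solve-∀

  yv′ : Adj T′ y v
  yv′ = ≡true⇒Adj T′ (setEdge-same G₅ (≢-sym v≢y) true (inj₁ (refl , refl)))

  uy′ : Adj T′ u y
  uy′ = ≡true⇒Adj T′ (trans (setEdge-other G₅ (≢-sym v≢y) true (¬SamePair (inj₁ u≢y) (inj₁ u≢v)))
                             (setEdge-same G₄ u≢y true (inj₁ (refl , refl))))

  xz′ : Adj T′ x z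
  xz′ = ≡true⇒Adj T′ (trans (T′-agrees-G₃ (¬SamePair (inj₁ (≢-sym u≢x)) (inj₁ (≢-sym v≢x)))
                                  (¬SamePair (inj₁ (≢-sym u≢x)) (inj₁ x≢y)) (¬SamePair (inj₁ x≢y) (inj₁ (≢-sym v≢x))))
                             (setEdge-same G₂ x≢z true (inj₁ (refl , refl))))

  Adj-kept : ∀ {a c} → Adj G a c → a ≢ y → c ≢ y → ¬ SamePair u v a c → Adj T′ a c
  Adj-kept ac a≢y c≢y ¬uv = ≡true⇒Adj T′
    (setEdge-keeps-true G₅ (≢-sym v≢y) (setEdge-keeps-true G₄ u≢y
      (trans (setEdge-other G₃ u≢v false ¬uv) (setEdge-keeps-true G₂ x≢z
        (trans (G₂-agrees (¬SamePair (inj₂ c≢y) (inj₁ a≢y)) (¬SamePair (inj₁ a≢y) (inj₂ c≢y))) (Adj⇒≡true G ac))))))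

  v-neighbour′ : ∀ {j} → Adj T′ v j → j ≡ y
  v-neighbour′ {j} vj with j ≟ y
  ... | yes j≡y = j≡y
  ... | no j≢y = contradiction (trans (sym (Adj⇒≡true T′ vj))
                   (trans (setEdge-other G₅ (≢-sym v≢y) true (¬SamePair (inj₁ v≢y) (inj₂ j≢y)))
                   (trans (setEdge-other G₄ u≢y true (¬SamePair (inj₁ (≢-sym u≢v)) (inj₁ v≢y))) (v-isolated₄ j)))) λ ()

  y-neighbours′ : ∀ {j} → Adj T′ y j → j ≡ u ⊎ j ≡ v
  y-neighbours′ {j} yj with j ≟ u | j ≟ v
  ... | yes j≡u | _ = inj₁ j≡u
  ... | no _ | yes j≡v = inj₂ j≡v
  ... | no j≢u | no j≢v = contradiction (trans (sym (Adj⇒≡true T′ yj))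
    (trans (T′-agrees-G₂ (¬SamePair (inj₁ (≢-sym x≢y)) (inj₁ y≢z)) (¬SamePair (inj₁ (≢-sym u≢y)) (inj₁ (≢-sym v≢y)))
                  (¬SamePair (inj₁ (≢-sym u≢y)) (inj₂ j≢u)) (¬SamePair (inj₂ j≢v) (inj₁ (≢-sym v≢y))))
           (y-isolated₂ j))) λ ()

  AvoidsXYV : Fin n → Set
  AvoidsXYV a = x ≢ a × y ≢ a × v ≢ a

  Adj-restored : ∀ {a b} → AvoidsXYV a → AvoidsXYV b → Adj T′ a b → Adj G a b
  Adj-restored {a} {b} (x≢a , y≢a , v≢a) (x≢b , y≢b , v≢b) ab = ≡true⇒Adj G (trans (sym unchanged) (Adj⇒≡true T′ ab))
    where
    unchanged : adj T′ a b ≡ adj G a b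
    unchanged = trans
      (T′-agrees-G₂ (¬SamePair (inj₁ (≢-sym x≢a)) (inj₂ (≢-sym x≢b))) (¬SamePair (inj₂ (≢-sym v≢b)) (inj₁ (≢-sym v≢a)))
                    (¬SamePair (inj₂ (≢-sym y≢b)) (inj₁ (≢-sym y≢a))) (¬SamePair (inj₁ (≢-sym y≢a)) (inj₁ (≢-sym v≢a))))
      (G₂-agrees (¬SamePair (inj₁ (≢-sym x≢a)) (inj₁ (≢-sym y≢a))) (¬SamePair (inj₁ (≢-sym y≢a)) (inj₂ (≢-sym y≢b))))

  x-adj-kept : ∀ {w} → w ≢ y → w ≢ z → adj T′ x w ≡ adj G x w
  x-adj-kept w≢y w≢z = trans
    (T′-agrees-G₂ (¬SamePair (inj₂ w≢z) (inj₁ x≢z)) (¬SamePair (inj₁ (≢-sym u≢x)) (inj₁ (≢-sym v≢x)))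
           (¬SamePair (inj₁ (≢-sym u≢x)) (inj₁ x≢y)) (¬SamePair (inj₁ x≢y) (inj₁ (≢-sym v≢x))))
    (G₂-agrees (¬SamePair (inj₂ w≢y) (inj₁ x≢y)) (¬SamePair (inj₁ x≢y) (inj₁ x≢z)))

  joined-in-T′ : ∀ {a d} → a ≡ x ⊎ a ≡ z → d ≡ x ⊎ d ≡ z → Walk T′ a d
  joined-in-T′ (inj₁ refl) (inj₁ refl) = here
  joined-in-T′ (inj₂ refl) (inj₂ refl) = here
  joined-in-T′ (inj₁ refl) (inj₂ refl) = step xz′ here
  joined-in-T′ (inj₂ refl) (inj₁ refl) = step (Adj-sym T′ xz′) here

  edge-in-T′ : ∀ {a c} → Adj G a c → a ≢ y → c ≢ y → Walk T′ a c
  edge-in-T′ {a} {c} ac a≢y c≢y with samePair? u v a c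
  ... | yes (inj₁ (refl , refl)) = step uy′ (step yv′ here)
  ... | yes (inj₂ (refl , refl)) = step (Adj-sym T′ yv′) (step (Adj-sym T′ uy′) here)
  ... | no ¬uv = step (Adj-kept ac a≢y c≢y ¬uv) here

  walk-avoiding-y : ∀ {a b} → Walk G a b → a ≢ y → b ≢ y → Walk T′ a b
  walk-avoiding-y here _ _ = here
  walk-avoiding-y (step {j = c} ac w) a≢y b≢y with c ≟ y
  walk-avoiding-y (step ay here) a≢y b≢y | yes refl = ⊥-elim (b≢y refl)
  walk-avoiding-y (step ay (step yd w)) a≢y b≢y | yes refl =
    joined-in-T′ (y-neighbours (Adj-sym G ay)) (y-neighbours yd) ++ʷ walk-avoiding-y w (≢-sym (Adj⇒≢ G yd)) b≢y
  ... | no c≢y = edge-in-T′ ac a≢y c≢y ++ʷ walk-avoiding-y w c≢y b≢y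

  T′-connected : Connected G → Connected T′
  T′-connected connected i j = to-u i ++ʷ reverseʷ (to-u j)
    where
    to-u : ∀ w → Walk T′ w u
    to-u w with w ≟ y
    ... | yes refl = step (Adj-sym T′ uy′) here
    ... | no w≢y = walk-avoiding-y (connected w u) w≢y u≢y

  v-off-cycle : ∀ {c cs} → CycleAt T′ c cs → v ∉ c ∷ cs
  v-off-cycle {c} {cs} = leaf-∉-cycle {c = c} {cs = cs} {G = T′} v-neighbour′

  y-off-cycle : ∀ {c cs} → CycleAt T′ c cs → y ∉ c ∷ cs
  y-off-cycle {c} {cs} = ∉-cycle-if-neighbours {c = c} {cs = cs} {G = T′} y-neighbours′ v-off-cycle

  x-off-cycle : ∀ {cs} → ¬ CycleAt T′ x cs
  x-off-cycle cyc@(long , (x∉L ∷ unique-L) , _) with viewCycle {G = T′} cyc | y-off-cycle cyc | v-off-cycle cyc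
  ... | record { first = a ; last = b ; middle = mid ; shape = refl ; w-first = xa ; path = path ; last-w = bx
               ; first≢last = a≢b } | y∉ | v∉ = close (a ≟ z) (b ≟ z)
    where
    L = a ∷ (mid ∷ʳ b)
    y∉L : All (y ≢_) L
    y∉L = ¬Any⇒All¬ L (y∉ ∘ there)
    path-in-G : Linked (Adj G) L
    path-in-G = Linked-restrict Adj-restored (All.zip (x∉L , All.zip (y∉L , ¬Any⇒All¬ L (v∉ ∘ there)))) path
    x-edge : ∀ {w} → w ∈ L → w ≢ z → Adj T′ x w → Adj G x w
    x-edge w∈L w≢z xw = ≡true⇒Adj G (trans (sym (x-adj-kept (≢-sym (All.lookup y∉L w∈L)) w≢z)) (Adj⇒≡true T′ xw))
    a∈L : a ∈ L
    a∈L = here refl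
    b∈L : b ∈ L
    b∈L = there (∈-++⁺ʳ mid (here refl))
    -- A G-cycle results from replacing the T′-edge x–z, if it is used, by the G-path x–y–z.
    close : Dec (a ≡ z) → Dec (b ≡ z) → ⊥
    close (yes refl) (yes refl) = a≢b refl
    close (yes refl) (no b≢z) = acyclic (x , y ∷ L , s≤s (s≤s z≤n) , (x≢y ∷ x∉L) ∷ y∉L ∷ unique-L ,
      xy ∷ yz ∷ Linked-∷ʳ (a ∷ mid) path-in-G (Adj-sym G (x-edge b∈L b≢z (Adj-sym T′ bx))))
    close (no a≢z) (yes refl) = acyclic (x , L ∷ʳ y ,
      s≤s (subst (1 ≤_) (sym (length-++-sucʳ (mid ∷ʳ b) y [])) (s≤s z≤n)) ,
      ∷ʳ⁺ x∉L x≢y ∷ Unique-∷ʳ unique-L (All.map ≢-sym y∉L) ,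
      x-edge a∈L a≢z xa ∷ Linked-∷ʳ L (Linked-∷ʳ (a ∷ mid) path-in-G (Adj-sym G yz)) (Adj-sym G xy))
    close (no a≢z) (no b≢z) = acyclic (x , L , long , (x∉L ∷ unique-L) ,
      x-edge a∈L a≢z xa ∷ Linked-∷ʳ (a ∷ mid) path-in-G (Adj-sym G (x-edge b∈L b≢z (Adj-sym T′ bx))))

  T′-acyclic : ¬ Cycle T′
  T′-acyclic (c , cs , cyc) with DecMembership._∈?_ _≟_ x (c ∷ cs)
  ... | yes x∈ = x-off-cycle (proj₂ (CycleAt-through {G = T′} cyc x∈))
  ... | no x∉ = acyclic (c , cs , CycleAt-restrict {G = G} {H = T′} Adj-restored
                  (All.zip (¬Any⇒All¬ _ x∉ , All.zip (¬Any⇒All¬ _ (y-off-cycle cyc) , ¬Any⇒All¬ _ (v-off-cycle cyc)))) cyc)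

  roots-decrease : ∀ d → 240 * (2 + length (edges G)) ≤ suc d →
    sum (map (λ e → suc (absRoot (suc d) (degSum T′ e))) (edges T′)) < sum (map (λ e → absRoot (suc d) (degSum G e)) (edges G))
  roots-decrease d large = cancel-gap
    (begin
      W + (suc (ρ 4) + R (x , z) + suc (ρ (4 + t)))     ≡⟨ cong (W +_) (cong₂ _+_ (cong₂ _+_ at-xy at-yz) at-uv) ⟨
      W + (R (x , y) + R (y , z) + R (u , v))           ≡⟨ cong (_+ (R (x , y) + R (y , z) + R (u , v))) W≡ ⟩
      ∑∑ (edgeWeight T′ R) + (R (x , y) + R (y , z) + R (u , v)) ≡⟨ balance (edgeSum-additive R R-sym) ⟩
      ∑∑ (edgeWeight G R) + (R (x , z) + R (u , y) + R (y , v)) ≡⟨ cong₂ _+_ G≡ (cong₂ _+_ (cong (R (x , z) +_) at-uy) at-yv) ⟩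
      S + m + (R (x , z) + suc (ρ (5 + t)) + suc (ρ 3)) ∎)
    (absRoot-gap m (suc d) t large)
    where
    open ≡-Reasoning
    m t : ℕ
    m = length (edges G)
    t = deg G u ∸ 3
    ρ : ℕ → ℕ
    ρ = absRoot (suc d)
    deg-u≡ : deg G u ≡ 3 + t
    deg-u≡ = sym (m+[n∸m]≡n deg-u)
    R : Fin n × Fin n → ℕ
    R e = suc (ρ (degSum G e))
    R-sym : ∀ i j → R (i , j) ≡ R (j , i)
    R-sym i j = cong (suc ∘ ρ) (+-comm (deg G i) (deg G j))
    W S : ℕ
    W = sum (map (λ e → suc (ρ (degSum T′ e))) (edges T′))
    S = sum (map (ρ ∘ degSum G) (edges G))
    W≡ : W ≡ ∑∑ (edgeWeight T′ R)
    W≡ = trans (cong sum (map-cong (λ e → cong (suc ∘ ρ) (cong₂ _+_ (deg-preserved (proj₁ e)) (deg-preserved (proj₂ e))))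
                                   (edges T′)))
               (sum-edges T′ R)
    G≡ : ∑∑ (edgeWeight G R) ≡ S + m
    G≡ = trans (sym (sum-edges G R)) (sum-map-suc (ρ ∘ degSum G) (edges G))
    at-xy : R (x , y) ≡ suc (ρ 4)
    at-xy = cong (suc ∘ ρ) (cong₂ _+_ deg-x deg-y)
    at-yz : R (y , z) ≡ R (x , z)
    at-yz = cong (λ s → suc (ρ (s + deg G z))) (trans deg-y (sym deg-x))
    at-uv : R (u , v) ≡ suc (ρ (4 + t))
    at-uv = cong (suc ∘ ρ) (trans (cong₂ _+_ deg-u≡ deg-v) (+-comm (3 + t) 1))
    at-uy : R (u , y) ≡ suc (ρ (5 + t))
    at-uy = cong (suc ∘ ρ) (trans (cong₂ _+_ deg-u≡ deg-y) (+-comm (3 + t) 2))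
    at-yv : R (y , v) ≡ suc (ρ 3)
    at-yv = cong (suc ∘ ρ) (cong₂ _+_ deg-y deg-v)

lemma2p3 : (n k : ℕ) (T : Graph n) → IsTree T → pendentCount T ≡ k → E2NonEmpty T →
    (u v : Fin n) → Adj T u v → (r : ℕ) → deg T u ≡ r → 3 ≤ r → deg T v ≡ 1 →
    Σ (Graph n) (λ T′ → IsTree T′ × pendentCount T′ ≡ k × ABS-gt T T′)
lemma2p3 n k T (n≥1 , connected , acyclic) pendent≡k (x , y , xy , deg-x , deg-y) u v uv r deg-u≡r r≥3 deg-v
  with deg2-other-neighbour T deg-y (Adj-sym T xy)
... | z , z≢x , yz =
  T′ , (n≥1 , T′-connected connected , T′-acyclic) ,
  trans (pendentCount-cong T T′ deg-preserved) pendent≡k ,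
  ABS-gt-from-roots T T′ d (roots-decrease d (n≤1+n d))
  where
  open Relocation T acyclic xy yz z≢x deg-x deg-y uv (subst (3 ≤_) (sym deg-u≡r) r≥3) deg-v
  d : ℕ
  d = 240 * (2 + length (edges T))
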